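{- Let $G=(V,E)$ be a (finite simple) graph and let $C\subseteq V$ be a clique, and put $I=V\setminus C$. Consider the following procedure: for every subset $I_1\subseteq I$, set $I_2=I\setminus I_1$, order the vertices of $C$ as $v_1,\dots,v_{|C|}$ in non-increasing order of the value $|N(v)\cap I_2|-|N(v)\cap I_1|$, and for every $m\in\{0,1,\dots,|C|\}$ set $C_1=\{v_1,\dots,v_m\}$, $C_2=C\setminus C_1$ and compute the size of the cut $(C_1\cup I_1,\,C_2\cup I_2)$; among all these candidate cuts, return one of largest size (starting from a recorded best size $0$ and replacing the recorded cut whenever a candidate's size is at least the recorded best size). Then the returned cut $(V_1,V_2)$ is a maximum cut of $G$.
   Context: $N(v)=\{u\in V:(u,v)\in E\}$ denotes the neighborhood of $v$. A cut of $G$ is a partition $(V_1,V_2)$ of $V$; its size is the number of edges with one endpoint in $V_1$ and the other in $V_2$. A maximum cut is a cut of maximum size. The graph $G$ is not assumed to be a split graph. -}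

module Defs where

open import Data.Nat using (ℕ; zero; suc; _≤_; _<ᵇ_; _≤ᵇ_)
open import Data.Bool using (Bool; true; false; _∧_; _xor_; if_then_else_)
open import Data.Fin using (Fin; toℕ; _≟_)
open import Data.Fin.Subset using (Subset; _∈_; _⊆_; ∁; _∩_; _∪_; _─_; ∣_∣; ⊥)
open import Data.Vec using (tabulate; lookup)
open import Data.List using (List; []; _∷_; map; allFin; upTo; take; foldl; concatMap)
open import Data.Nat.ListAction using (sum)
open import Data.Bool.ListAction using (any)
import Data.List.Membership.Propositional as LM
open import Data.List.Relation.Unary.Unique.Propositional using (Unique)
open import Data.List.Relation.Unary.Linked using (Linked)
open import Data.Integer as ℤ using (ℤ; +_)
open import Data.Product using (_×_; _,_; proj₁)
open import Relation.Nullary using (¬_)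
open import Relation.Nullary.Decidable using (⌊_⌋)
open import Relation.Binary.PropositionalEquality using (_≡_)
open import Function.Bundles using (_⇔_)

record Graph (n : ℕ) : Set where
  field
    adj   : Fin n → Fin n → Bool
    sym   : ∀ u v → adj u v ≡ adj v u
    irrefl : ∀ v → adj v v ≡ false
open Graph public

N : ∀ {n} → Graph n → Fin n → Subset n
N G v = tabulate (λ u → adj G u v)

IsClique : ∀ {n} → Graph n → Subset n → Set
IsClique G C = ∀ u v → u ∈ C → v ∈ C → ¬ (u ≡ v) → adj G u v ≡ true

-- A cut (V₁ , V₂) with V₂ = V ∖ V₁ is represented by the subset V₁.
-- Its size: number of edges {u,v} (counted once, u < v) with exactly one endpoint in V₁.
cutSize : ∀ {n} → Graph n → Subset n → ℕ
cutSize {n} G V₁ =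
  sum (map (λ u → sum (map (λ v →
        if (toℕ u <ᵇ toℕ v) ∧ adj G u v ∧ (lookup V₁ u xor lookup V₁ v) then 1 else 0)
      (allFin n))) (allFin n))

IsMaxCut : ∀ {n} → Graph n → Subset n → Set
IsMaxCut G V₁ = ∀ W → cutSize G W ≤ cutSize G V₁

listSet : ∀ {n} → List (Fin n) → Subset n
listSet l = tabulate (λ v → any (λ w → ⌊ v ≟ w ⌋) l)

key : ∀ {n} → Graph n → (I₁ I₂ : Subset n) → Fin n → ℤ
key G I₁ I₂ v = (+ ∣ N G v ∩ I₂ ∣) ℤ.- (+ ∣ N G v ∩ I₁ ∣)

ValidOrder : ∀ {n} → Graph n → (C I₁ I₂ : Subset n) → List (Fin n) → Set
ValidOrder G C I₁ I₂ l =
  Unique l × (∀ v → (v LM.∈ l) ⇔ (v ∈ C)) ×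
  Linked (λ u v → key G I₁ I₂ v ℤ.≤ key G I₁ I₂ u) l

ValidEnum : ∀ {n} → Subset n → List (Subset n) → Set
ValidEnum I subs = (∀ I₁ → I₁ ⊆ I → I₁ LM.∈ subs) × (∀ I₁ → I₁ LM.∈ subs → I₁ ⊆ I)

candidate : ∀ {n} → (I₁ : Subset n) → List (Fin n) → ℕ → Subset n
candidate I₁ l m = listSet (take m l) ∪ I₁

step : ∀ {n} → Graph n → Subset n × ℕ → Subset n → Subset n × ℕ
step G (best , b) S = if b ≤ᵇ cutSize G S then (S , cutSize G S) else (best , b)

-- Initial recorded size 0
-- (initial recorded cut arbitrary, here V₁ = ∅; it is always replaced).
procedure : ∀ {n} → Graph n → (C : Subset n) → List (Subset n) →
            (Subset n → List (Fin n)) → Subset n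
procedure G C subs ord =
  proj₁ (foldl (step G) (⊥ , 0)
    (concatMap (λ I₁ → map (candidate I₁ (ord I₁)) (upTo (suc ∣ C ∣))) subs))

{-# OPTIONS --safe #-}
module Submission where

-- Represent a cut by the indicator x of its first side and split V into the clique C and
-- I = V ∖ C.  Counting crossing edges as ordered pairs, twice the cut size is A + 2B + D, where
-- A, B and D count the crossing pairs inside C, between C and I, and inside I.  For fixed
-- I₁ = x ∩ I the term D is fixed; since C is a clique, A only depends on the number k of clique
-- vertices on the first side; and a clique vertex u contributes |N(u) ∩ I₂| to B on the first
-- side and |N(u) ∩ I₁| on the second.  An exchange argument shows that putting the k clique
-- vertices of largest key |N(u) ∩ I₂| − |N(u) ∩ I₁| on the first side maximises B.  So every
-- cut is dominated by one of the candidates, and the procedure keeps a candidate of maximum size.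

open import Defs hiding (sym)
open import Data.Bool using (Bool; true; false; _∧_; _∨_; not; _xor_; if_then_else_)
open import Data.Bool.ListAction using (any)
open import Data.Bool.Properties using (∧-zeroʳ; ∧-identityʳ; ∨-identityʳ; xor-comm; xor-same)
open import Data.Fin using (Fin; zero; suc; toℕ)
open import Data.Fin.Properties using (_≟_; toℕ-injective)
open import Data.Fin.Subset using (Subset; _⊆_; ∁; _─_; _∩_; ∣_∣; ⊥) renaming (_∈_ to _∈ₛ_)
open import Data.Fin.Subset.Properties using (x∈∁p⇒x∉p; p∩q⊆q)
import Data.Integer as ℤ
import Data.Integer.Properties as ℤ
open import Data.Integer.Tactic.RingSolver using (solve-∀)
open import Data.List using (List; []; _∷_; length; map; allFin; foldl; take; upTo; concatMap)
open import Data.List.Properties using (map-tabulate)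
open import Data.List.Membership.Propositional using (_∈_)
open import Data.List.Membership.Propositional.Properties using (∈-map⁺; ∈-concatMap⁺; ∈-upTo⁺)
import Data.List.Relation.Binary.Sublist.Propositional as Sublist
open import Data.List.Relation.Binary.Sublist.Propositional.Properties using (take-⊆)
open import Data.List.Relation.Unary.All using (All; []; _∷_)
import Data.List.Relation.Unary.All as All
open import Data.List.Relation.Unary.All.Properties using (All¬⇒¬Any)
open import Data.List.Relation.Unary.AllPairs using (AllPairs; []; _∷_)
import Data.List.Relation.Unary.AllPairs as AllPairs
open import Data.List.Relation.Unary.Any using (here; there)
import Data.List.Relation.Unary.Any as Any
open import Data.List.Relation.Unary.Linked using (Linked)
open import Data.List.Relation.Unary.Linked.Properties using (Linked⇒AllPairs)
open import Data.List.Relation.Unary.Unique.Propositional using (Unique)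
open import Data.Nat using (ℕ; zero; suc; _+_; _*_; _≤_; _<ᵇ_; _≤ᵇ_; z≤n; s≤s)
open import Data.Nat.ListAction using (sum)
open import Data.Nat.Properties hiding (_≟_)
open import Algebra.Properties.CommutativeSemigroup +-commutativeSemigroup using (interchange; x∙yz≈y∙xz)
open import Data.Product using (_×_; _,_; proj₁; proj₂)
open import Data.Vec using ([]; _∷_; lookup)
open import Data.Vec.Properties using (lookup∘tabulate; lookup-map; lookup-zipWith; []=⇒lookup; lookup⇒[]=)
open import Function using (_∘_; id)
open import Function.Bundles using (_⇔_; Equivalence)
open import Relation.Binary.PropositionalEquality
open import Relation.Nullary using (yes; no; contradiction; ofʸ; ofⁿ)
open import Relation.Nullary.Decidable using (⌊_⌋; does; isYes≗does; dec-true; dec-false)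

module _ {n : ℕ} where
  open import Data.List.Membership.DecPropositional (_≟_ {n}) public using (_∈?_)

private
  variable
    A B : Set

⟦_⟧ : Bool → ℕ
⟦ b ⟧ = if b then 1 else 0

∑ : List A → (A → ℕ) → ℕ
∑ xs f = sum (map f xs)

count : (A → Bool) → List A → ℕ
count p xs = ∑ xs (λ x → ⟦ p x ⟧)

∑-cong : ∀ (xs : List A) {f g : A → ℕ} → (∀ x → x ∈ xs → f x ≡ g x) → ∑ xs f ≡ ∑ xs g
∑-cong []       eq = refl
∑-cong (x ∷ xs) eq = cong₂ _+_ (eq x (here refl)) (∑-cong xs (λ y y∈xs → eq y (there y∈xs)))

∑-zero : ∀ (xs : List A) → ∑ xs (λ _ → 0) ≡ 0
∑-zero []       = refl
∑-zero (x ∷ xs) = ∑-zero xs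

∑-distrib-+ : ∀ (xs : List A) (f g : A → ℕ) → ∑ xs (λ x → f x + g x) ≡ ∑ xs f + ∑ xs g
∑-distrib-+ []       f g = refl
∑-distrib-+ (x ∷ xs) f g =
  trans (cong (f x + g x +_) (∑-distrib-+ xs f g)) (interchange (f x) (g x) (∑ xs f) (∑ xs g))

∑-comm : ∀ (xs : List A) (ys : List B) (f : A → B → ℕ) →
         ∑ xs (λ x → ∑ ys (f x)) ≡ ∑ ys (λ y → ∑ xs (λ x → f x y))
∑-comm []       ys f = sym (∑-zero ys)
∑-comm (x ∷ xs) ys f =
  trans (cong (∑ ys (f x) +_) (∑-comm xs ys f)) (sym (∑-distrib-+ ys (f x) (λ y → ∑ xs (λ x → f x y))))

∑-if-split : ∀ (xs : List A) (p : A → Bool) (f : A → ℕ) →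
  ∑ xs f ≡ ∑ xs (λ x → if p x then f x else 0) + ∑ xs (λ x → if p x then 0 else f x)
∑-if-split xs p f = trans (∑-cong xs (λ x _ → split (p x))) (∑-distrib-+ xs _ _)
  where
  split : ∀ {x} b → f x ≡ (if b then f x else 0) + (if b then 0 else f x)
  split true  = sym (+-identityʳ _)
  split false = refl

∑-if : ∀ (xs : List A) (p : A → Bool) (a b : ℕ) →
  ∑ xs (λ x → if p x then a else b) ≡ a * count p xs + b * count (not ∘ p) xs
∑-if []       p a b = sym (cong₂ _+_ (*-zeroʳ a) (*-zeroʳ b))
∑-if (x ∷ xs) p a b with p x
... | true  = trans (cong (a +_) (∑-if xs p a b))
  (trans (sym (+-assoc a (a * k) (b * k′))) (cong (_+ b * k′) (sym (*-suc a k))))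
  where k = count p xs ; k′ = count (not ∘ p) xs
... | false = trans (cong (b +_) (∑-if xs p a b))
  (trans (x∙yz≈y∙xz b (a * k) (b * k′)) (cong (a * k +_) (sym (*-suc b k′))))
  where k = count p xs ; k′ = count (not ∘ p) xs

∑-1≡length : ∀ (xs : List A) → ∑ xs (λ _ → 1) ≡ length xs
∑-1≡length []       = refl
∑-1≡length (x ∷ xs) = cong suc (∑-1≡length xs)

count≤length : ∀ (p : A → Bool) xs → count p xs ≤ length xs
count≤length p []       = z≤n
count≤length p (x ∷ xs) with p x
... | true  = s≤s (count≤length p xs)
... | false = m≤n⇒m≤1+n (count≤length p xs)

count+count-not : ∀ (p : A → Bool) xs → count p xs + count (not ∘ p) xs ≡ length xs
count+count-not p []       = refl
count+count-not p (x ∷ xs) with p x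
... | true  = cong suc (count+count-not p xs)
... | false = trans (+-suc (count p xs) _) (cong suc (count+count-not p xs))

-- w x b is the weight of x when it is placed on side b.
topSum : (A → Bool → ℕ) → ℕ → List A → ℕ
topSum w zero    xs       = ∑ xs (λ x → w x false)
topSum w (suc m) []       = 0
topSum w (suc m) (x ∷ xs) = w x true + topSum w m xs

Dominates : (A → Bool → ℕ) → A → A → Set
Dominates w x y = w y true + w x false ≤ w x true + w y false

topSum-exchange : ∀ {w : A → Bool → ℕ} {x} {xs} {j} → All (Dominates w x) xs → suc j ≤ length xs →
  w x false + topSum w (suc j) xs ≤ w x true + topSum w j xs
topSum-exchange {w = w} {x} {y ∷ ys} {zero} (x≽y ∷ _) _ = begin
  w x false + (w y true + S)   ≡⟨ x∙yz≈y∙xz (w x false) (w y true) S ⟩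
  w y true + (w x false + S)   ≡⟨ +-assoc (w y true) (w x false) S ⟨
  w y true + w x false + S     ≤⟨ +-monoˡ-≤ S x≽y ⟩
  w x true + w y false + S     ≡⟨ +-assoc (w x true) (w y false) S ⟩
  w x true + (w y false + S)   ∎
  where open ≤-Reasoning
        S = ∑ ys (λ z → w z false)
topSum-exchange {w = w} {x} {y ∷ ys} {suc j} (_ ∷ x≽ys) (s≤s j<ys) = begin
  w x false + (w y true + topSum w (suc j) ys) ≡⟨ x∙yz≈y∙xz (w x false) (w y true) _ ⟩
  w y true + (w x false + topSum w (suc j) ys) ≤⟨ +-monoʳ-≤ (w y true) (topSum-exchange x≽ys j<ys) ⟩
  w y true + (w x true + topSum w j ys)        ≡⟨ x∙yz≈y∙xz (w y true) (w x true) _ ⟩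
  w x true + (w y true + topSum w j ys)        ∎
  where open ≤-Reasoning

∑≤topSum : ∀ {w : A → Bool → ℕ} (p : A → Bool) {xs} → AllPairs (Dominates w) xs →
  ∑ xs (λ x → w x (p x)) ≤ topSum w (count p xs) xs
∑≤topSum p {[]}     []          = z≤n
∑≤topSum {w = w} p {x ∷ xs} (x≽xs ∷ sorted) with p x
... | true  = +-monoʳ-≤ (w x true) (∑≤topSum p sorted)
... | false = ≤-trans (+-monoʳ-≤ (w x false) (∑≤topSum p sorted)) (shift (count p xs) (count≤length p xs))
  where
  shift : ∀ j → j ≤ length xs → w x false + topSum w j xs ≤ topSum w j (x ∷ xs)
  shift zero    _     = ≤-refl
  shift (suc j) j<xs = topSum-exchange x≽xs j<xs

topSum-count : ∀ {m} (xs : List A) → m ≤ length xs → topSum (λ _ → ⟦_⟧) m xs ≡ m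
topSum-count {m = zero}  xs       _         = ∑-zero xs
topSum-count {m = suc m} (x ∷ xs) (s≤s m≤) = cong suc (topSum-count xs m≤)

∑-allFin-suc : ∀ n (f : Fin (suc n) → ℕ) → ∑ (allFin (suc n)) f ≡ f zero + ∑ (allFin n) (f ∘ suc)
∑-allFin-suc n f =
  cong (λ fs → f zero + sum fs) (trans (map-tabulate suc f) (sym (map-tabulate id (f ∘ suc))))

∑-allFin-≟ : ∀ {n} (x : Fin n) (f : Fin n → ℕ) →
  ∑ (allFin n) (λ u → if does (u ≟ x) then f u else 0) ≡ f x
∑-allFin-≟ {suc n} zero    f = trans (∑-allFin-suc n (λ u → if does (u ≟ zero) then f u else 0))
  (trans (cong (f zero +_) (∑-zero (allFin n))) (+-identityʳ (f zero)))
∑-allFin-≟ {suc n} (suc x) f = trans (∑-allFin-suc n (λ u → if does (u ≟ suc x) then f u else 0))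
  (∑-allFin-≟ x (f ∘ suc))

∑-allFin-∈? : ∀ {n} {xs : List (Fin n)} → Unique xs → (f : Fin n → ℕ) →
  ∑ (allFin n) (λ u → if does (u ∈? xs) then f u else 0) ≡ ∑ xs f
∑-allFin-∈? {n} {[]}     []           f = ∑-zero (allFin n)
∑-allFin-∈? {n} {x ∷ xs} (x∉xs ∷ !xs) f = begin
  ∑ (allFin n) (λ u → if does (u ∈? x ∷ xs) then f u else 0)
    ≡⟨ ∑-cong (allFin n) (λ u _ → split u) ⟩
  ∑ (allFin n) (λ u → (if does (u ≟ x) then f u else 0) + (if does (u ∈? xs) then f u else 0))
    ≡⟨ ∑-distrib-+ (allFin n) _ _ ⟩
  ∑ (allFin n) (λ u → if does (u ≟ x) then f u else 0) +
  ∑ (allFin n) (λ u → if does (u ∈? xs) then f u else 0)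
    ≡⟨ cong₂ _+_ (∑-allFin-≟ x f) (∑-allFin-∈? !xs f) ⟩
  f x + ∑ xs f ∎
  where
  open ≡-Reasoning
  split : ∀ u → (if does (u ∈? x ∷ xs) then f u else 0) ≡
                (if does (u ≟ x) then f u else 0) + (if does (u ∈? xs) then f u else 0)
  split u with u ≟ x
  ... | yes refl rewrite dec-false (u ∈? xs) (All¬⇒¬Any x∉xs) = sym (+-identityʳ (f u))
  ... | no _     = refl

∣p∣≡count : ∀ {n} (p : Subset n) → ∣ p ∣ ≡ count (lookup p) (allFin n)
∣p∣≡count []                  = refl
∣p∣≡count {suc n} (true ∷ p)  =
  trans (cong suc (∣p∣≡count p)) (sym (∑-allFin-suc n (λ u → ⟦ lookup (true ∷ p) u ⟧)))
∣p∣≡count {suc n} (false ∷ p) =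
  trans (∣p∣≡count p) (sym (∑-allFin-suc n (λ u → ⟦ lookup (false ∷ p) u ⟧)))

lookup-listSet : ∀ {n} (xs : List (Fin n)) u → lookup (listSet xs) u ≡ does (u ∈? xs)
lookup-listSet xs u = trans (lookup∘tabulate _ u) (any≡∈? xs)
  where
  any≡∈? : ∀ xs → any (λ w → ⌊ u ≟ w ⌋) xs ≡ does (u ∈? xs)
  any≡∈? []       = refl
  any≡∈? (w ∷ xs) = cong₂ _∨_ (isYes≗does (u ≟ w)) (any≡∈? xs)

∑-take≡topSum : ∀ {n} (w : Fin n → Bool → ℕ) m {xs} → Unique xs →
  ∑ xs (λ u → w u (does (u ∈? take m xs))) ≡ topSum w m xs
∑-take≡topSum w zero    _                  = refl
∑-take≡topSum w (suc m) {[]}     _          = refl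
∑-take≡topSum w (suc m) {x ∷ xs} (x∉xs ∷ !xs) =
  cong₂ _+_ (cong (w x) (dec-true (x ∈? x ∷ take m xs) (here refl)))
            (trans (∑-cong xs (λ u u∈xs → cong (λ b → w u (b ∨ does (u ∈? take m xs)))
                                                 (dec-false (u ≟ x) (≢-sym (All.lookup x∉xs u∈xs)))))
                   (∑-take≡topSum w m !xs))

module _ {n} {p : Subset n} {xs : List (Fin n)} (xs↔p : ∀ v → (v ∈ xs) ⇔ (v ∈ₛ p)) where

  ∈⇒lookup≡true : ∀ {v} → v ∈ xs → lookup p v ≡ true
  ∈⇒lookup≡true {v} v∈xs = []=⇒lookup (Equivalence.to (xs↔p v) v∈xs)

  lookup≡does-∈? : ∀ v → lookup p v ≡ does (v ∈? xs)
  lookup≡does-∈? v with lookup p v in eq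
  ... | true  = sym (dec-true (v ∈? xs) (Equivalence.from (xs↔p v) (lookup⇒[]= v p eq)))
  ... | false = sym (dec-false (v ∈? xs) λ v∈xs →
                  contradiction (trans (sym eq) (∈⇒lookup≡true v∈xs)) λ ())

  length≡∣p∣ : Unique xs → length xs ≡ ∣ p ∣
  length≡∣p∣ !xs = sym (begin
    ∣ p ∣                                                ≡⟨ ∣p∣≡count p ⟩
    ∑ (allFin n) (λ v → ⟦ lookup p v ⟧)
      ≡⟨ ∑-cong (allFin n) (λ v _ → cong ⟦_⟧ (lookup≡does-∈? v)) ⟩
    ∑ (allFin n) (λ v → if does (v ∈? xs) then 1 else 0) ≡⟨ ∑-allFin-∈? !xs (λ _ → 1) ⟩
    ∑ xs (λ _ → 1)                                       ≡⟨ ∑-1≡length xs ⟩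
    length xs                                            ∎)
    where open ≡-Reasoning

m-n≤o-p⇒m+p≤o+n : ∀ {m n o p} → ℤ.+ m ℤ.- ℤ.+ n ℤ.≤ ℤ.+ o ℤ.- ℤ.+ p → m + p ≤ o + n
m-n≤o-p⇒m+p≤o+n {m} {n} {o} {p} le = ℤ.drop‿+≤+
  (subst₂ ℤ._≤_ (cancelˡ (ℤ.+ m) (ℤ.+ n) (ℤ.+ p)) (cancelʳ (ℤ.+ o) (ℤ.+ p) (ℤ.+ n))
                (ℤ.+-monoˡ-≤ (ℤ.+ n ℤ.+ ℤ.+ p) le))
  where
  cancelˡ : ∀ a b c → (a ℤ.- b) ℤ.+ (b ℤ.+ c) ≡ a ℤ.+ c
  cancelˡ = solve-∀
  cancelʳ : ∀ a b c → (a ℤ.- b) ℤ.+ (c ℤ.+ b) ≡ a ℤ.+ c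
  cancelʳ = solve-∀

lookup-─ : ∀ {n} (p q : Subset n) v → lookup (p ─ q) v ≡ lookup p v ∧ not (lookup q v)
lookup-─ (b ∷ p) (true  ∷ q) zero    = sym (∧-zeroʳ b)
lookup-─ (b ∷ p) (false ∷ q) zero    = sym (∧-identityʳ b)
lookup-─ (_ ∷ p) (_     ∷ q) (suc v) = lookup-─ p q v

module _ {n} (G : Graph n) where

  crosses : (Fin n → Bool) → Fin n → Fin n → Bool
  crosses x u v = adj G u v ∧ (x u xor x v)

  crossings : (Fin n → Bool) → ℕ
  crossings x = ∑ (allFin n) (λ u → ∑ (allFin n) (λ v → ⟦ crosses x u v ⟧))

  crosses-sym : ∀ x u v → crosses x u v ≡ crosses x v u
  crosses-sym x u v = cong₂ _∧_ (Graph.sym G u v) (xor-comm (x u) (x v))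

  private
    ⟦crosses⟧-split : ∀ x u v → ⟦ crosses x u v ⟧ ≡
      ⟦ (toℕ u <ᵇ toℕ v) ∧ crosses x u v ⟧ + ⟦ (toℕ v <ᵇ toℕ u) ∧ crosses x v u ⟧
    ⟦crosses⟧-split x u v
      with toℕ u <ᵇ toℕ v | <ᵇ-reflects-< (toℕ u) (toℕ v) | toℕ v <ᵇ toℕ u | <ᵇ-reflects-< (toℕ v) (toℕ u)
    ... | true  | ofʸ u<v | true  | ofʸ v<u = contradiction v<u (<-asym u<v)
    ... | true  | _       | false | _       = sym (+-identityʳ _)
    ... | false | _       | true  | _       = cong ⟦_⟧ (crosses-sym x u v)
    ... | false | ofⁿ u≮v | false | ofⁿ v≮u with toℕ-injective (≤-antisym (≮⇒≥ v≮u) (≮⇒≥ u≮v))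
    ...   | refl rewrite Graph.irrefl G u = refl

  ∣N∩p∣≡∑ : ∀ u (p : Subset n) → ∣ N G u ∩ p ∣ ≡ ∑ (allFin n) (λ v → ⟦ adj G u v ∧ lookup p v ⟧)
  ∣N∩p∣≡∑ u p = trans (∣p∣≡count (N G u ∩ p)) (∑-cong (allFin n) λ v _ → cong ⟦_⟧
    (trans (lookup-zipWith _∧_ v (N G u) p)
           (cong (_∧ lookup p v) (trans (lookup∘tabulate _ v) (Graph.sym G v u)))))

  crossings≡2*cutSize : ∀ V → crossings (lookup V) ≡ 2 * cutSize G V
  crossings≡2*cutSize V = begin
    crossings x
      ≡⟨ ∑-cong vs (λ u _ → ∑-cong vs (λ v _ → ⟦crosses⟧-split x u v)) ⟩
    ∑ vs (λ u → ∑ vs (λ v → ordered u v + ordered v u))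
      ≡⟨ ∑-cong vs (λ u _ → ∑-distrib-+ vs (ordered u) (λ v → ordered v u)) ⟩
    ∑ vs (λ u → ∑ vs (ordered u) + ∑ vs (λ v → ordered v u))
      ≡⟨ ∑-distrib-+ vs (λ u → ∑ vs (ordered u)) (λ u → ∑ vs (λ v → ordered v u)) ⟩
    cutSize G V + ∑ vs (λ u → ∑ vs (λ v → ordered v u))
      ≡⟨ cong (cutSize G V +_) (∑-comm vs vs (λ u v → ordered v u)) ⟩
    cutSize G V + cutSize G V
      ≡⟨ cong (cutSize G V +_) (+-identityʳ (cutSize G V)) ⟨
    2 * cutSize G V ∎
    where
    open ≡-Reasoning
    vs : List (Fin n)
    vs = allFin n
    x : Fin n → Bool
    x = lookup V
    ordered : Fin n → Fin n → ℕ
    ordered u v = ⟦ (toℕ u <ᵇ toℕ v) ∧ crosses x u v ⟧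

module CliqueSplit {n} (G : Graph n) {C : Subset n} (clique : IsClique G C)
                   {L : List (Fin n)} (L-unique : Unique L) (L↔C : ∀ v → (v ∈ L) ⇔ (v ∈ₛ C)) where

  private
    vs : List (Fin n)
    vs = allFin n

  ∑ᵒ : (Fin n → ℕ) → ℕ
  ∑ᵒ f = ∑ vs (λ u → if lookup C u then 0 else f u)

  ∑ᵒ-cong : ∀ {f g : Fin n → ℕ} → (∀ u → lookup C u ≡ false → f u ≡ g u) → ∑ᵒ f ≡ ∑ᵒ g
  ∑ᵒ-cong f≗g = ∑-cong vs λ u _ → pointwise u
    where
    pointwise : ∀ u → (if lookup C u then 0 else _) ≡ (if lookup C u then 0 else _)
    pointwise u with lookup C u in eq
    ... | true  = refl
    ... | false = f≗g u eq

  ∑-split : ∀ f → ∑ vs f ≡ ∑ L f + ∑ᵒ f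
  ∑-split f = trans (∑-if-split vs (lookup C) f) (cong (_+ ∑ᵒ f) (begin
    ∑ vs (λ u → if lookup C u then f u else 0)
      ≡⟨ ∑-cong vs (λ u _ → cong (λ b → if b then f u else 0) (lookup≡does-∈? L↔C u)) ⟩
    ∑ vs (λ u → if does (u ∈? L) then f u else 0)
      ≡⟨ ∑-allFin-∈? L-unique f ⟩
    ∑ L f ∎))
    where open ≡-Reasoning

  ∑²-split : ∀ (g : Fin n → Fin n → ℕ) → (∀ u v → g u v ≡ g v u) →
    ∑ vs (λ u → ∑ vs (g u)) ≡
      (∑ L (λ u → ∑ L (g u)) + ∑ L (λ u → ∑ᵒ (g u))) +
      (∑ L (λ u → ∑ᵒ (g u)) + ∑ᵒ (λ u → ∑ᵒ (g u)))
  ∑²-split g g-sym = begin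
    ∑ vs (λ u → ∑ vs (g u))
      ≡⟨ ∑-cong vs (λ u _ → ∑-split (g u)) ⟩
    ∑ vs (λ u → ∑ L (g u) + ∑ᵒ (g u))
      ≡⟨ ∑-distrib-+ vs (λ u → ∑ L (g u)) (λ u → ∑ᵒ (g u)) ⟩
    ∑ vs (λ u → ∑ L (g u)) + ∑ vs (λ u → ∑ᵒ (g u))
      ≡⟨ cong₂ _+_ (∑-comm vs L g) (∑-split (λ u → ∑ᵒ (g u))) ⟩
    ∑ L (λ v → ∑ vs (λ u → g u v)) + (between + outside)
      ≡⟨ cong (_+ (between + outside))
              (∑-cong L (λ v _ → trans (∑-cong vs (λ u _ → g-sym u v)) (∑-split (g v)))) ⟩
    ∑ L (λ v → ∑ L (g v) + ∑ᵒ (g v)) + (between + outside)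
      ≡⟨ cong (_+ (between + outside)) (∑-distrib-+ L (λ v → ∑ L (g v)) (λ v → ∑ᵒ (g v))) ⟩
    (∑ L (λ u → ∑ L (g u)) + between) + (between + outside) ∎
    where
    open ≡-Reasoning
    between outside : ℕ
    between = ∑ L (λ u → ∑ᵒ (g u))
    outside = ∑ᵒ (λ u → ∑ᵒ (g u))

  crossingsInside crossingsBetween crossingsOutside : (Fin n → Bool) → ℕ
  crossingsInside  x = ∑ L (λ u → ∑ L (λ v → ⟦ crosses G x u v ⟧))
  crossingsBetween x = ∑ L (λ u → ∑ᵒ (λ v → ⟦ crosses G x u v ⟧))
  crossingsOutside x = ∑ᵒ (λ u → ∑ᵒ (λ v → ⟦ crosses G x u v ⟧))

  crossings-split : ∀ x → crossings G x ≡
    (crossingsInside x + crossingsBetween x) + (crossingsBetween x + crossingsOutside x)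
  crossings-split x = ∑²-split (λ u v → ⟦ crosses G x u v ⟧) (λ u v → cong ⟦_⟧ (crosses-sym G x u v))

  crosses-in-clique : ∀ x {u v} → u ∈ L → v ∈ L → crosses G x u v ≡ x u xor x v
  crosses-in-clique x {u} {v} u∈L v∈L with u ≟ v
  ... | yes refl rewrite Graph.irrefl G u | xor-same (x u) = refl
  ... | no u≢v
    rewrite clique u v (Equivalence.to (L↔C u) u∈L) (Equivalence.to (L↔C v) v∈L) u≢v = refl

  crossingsInside≡ : ∀ x →
    crossingsInside x ≡ count (not ∘ x) L * count x L + count x L * count (not ∘ x) L
  crossingsInside≡ x = trans
    (∑-cong L λ u u∈L → trans (∑-cong L λ v v∈L → cong ⟦_⟧ (crosses-in-clique x u∈L v∈L)) (row (x u)))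
    (∑-if L x (count (not ∘ x) L) (count x L))
    where
    row : ∀ b → ∑ L (λ v → ⟦ b xor x v ⟧) ≡ (if b then count (not ∘ x) L else count x L)
    row true  = refl
    row false = refl

  crossingsInside-cong : ∀ {x y} → count x L ≡ count y L → crossingsInside x ≡ crossingsInside y
  crossingsInside-cong {x} {y} kx≡ky =
    trans (crossingsInside≡ x)
          (trans (cong₂ (λ a b → a * b + b * a) k̄x≡k̄y kx≡ky) (sym (crossingsInside≡ y)))
    where
    k̄x≡k̄y : count (not ∘ x) L ≡ count (not ∘ y) L
    k̄x≡k̄y = +-cancelˡ-≡ (count x L) _ _
      (trans (count+count-not x L)
             (trans (sym (count+count-not y L)) (cong (_+ count (not ∘ y) L) (sym kx≡ky))))

  module Outside (I₁ : Subset n) where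

    AgreesOutside : (Fin n → Bool) → Set
    AgreesOutside x = ∀ u → lookup C u ≡ false → x u ≡ lookup I₁ u

    outerCrossings : Fin n → Bool → ℕ
    outerCrossings u b = ∑ᵒ (λ v → ⟦ adj G u v ∧ (b xor lookup I₁ v) ⟧)

    crossingsBetween-agrees : ∀ {x} → AgreesOutside x →
      crossingsBetween x ≡ ∑ L (λ u → outerCrossings u (x u))
    crossingsBetween-agrees {x} agree =
      ∑-cong L (λ u _ → ∑ᵒ-cong (λ v v∉C → cong (λ b → ⟦ adj G u v ∧ (x u xor b) ⟧) (agree v v∉C)))

    crossingsOutside-agrees : ∀ {x} → AgreesOutside x → crossingsOutside x ≡ crossingsOutside (lookup I₁)
    crossingsOutside-agrees agree = ∑ᵒ-cong λ u u∉C → ∑ᵒ-cong λ v v∉C →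
      cong₂ (λ a b → ⟦ adj G u v ∧ (a xor b) ⟧) (agree u u∉C) (agree v v∉C)

    crossings-mono : ∀ {x y} → AgreesOutside x → AgreesOutside y → count x L ≡ count y L →
      ∑ L (λ u → outerCrossings u (x u)) ≤ ∑ L (λ u → outerCrossings u (y u)) →
      crossings G x ≤ crossings G y
    crossings-mono {x} {y} x-agrees y-agrees kx≡ky bx≤by = begin
      crossings G x
        ≡⟨ crossings-split x ⟩
      (crossingsInside x + crossingsBetween x) + (crossingsBetween x + crossingsOutside x)
        ≤⟨ +-mono-≤ (+-mono-≤ (≤-reflexive (crossingsInside-cong kx≡ky)) between≤)
                    (+-mono-≤ between≤ (≤-reflexive outside≡)) ⟩
      (crossingsInside y + crossingsBetween y) + (crossingsBetween y + crossingsOutside y)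
        ≡⟨ crossings-split y ⟨
      crossings G y ∎
      where
      open ≤-Reasoning
      between≤ : crossingsBetween x ≤ crossingsBetween y
      between≤ = subst₂ _≤_ (sym (crossingsBetween-agrees x-agrees)) (sym (crossingsBetween-agrees y-agrees))
                            bx≤by
      outside≡ : crossingsOutside x ≡ crossingsOutside y
      outside≡ = trans (crossingsOutside-agrees x-agrees) (sym (crossingsOutside-agrees y-agrees))

    module _ (I₁⊆∁C : I₁ ⊆ ∁ C) where

      I₁-disjoint : ∀ {v} → lookup C v ≡ true → lookup I₁ v ≡ false
      I₁-disjoint {v} v∈C with lookup I₁ v in eq
      ... | false = refl
      ... | true  = contradiction (lookup⇒[]= v C v∈C) (x∈∁p⇒x∉p (I₁⊆∁C (lookup⇒[]= v I₁ eq)))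

      outerCrossings-true : ∀ u → outerCrossings u true ≡ ∣ N G u ∩ (∁ C ─ I₁) ∣
      outerCrossings-true u = sym (trans (∣N∩p∣≡∑ G u (∁ C ─ I₁)) (∑-cong vs λ v _ → pointwise v))
        where
        pointwise : ∀ v → ⟦ adj G u v ∧ lookup (∁ C ─ I₁) v ⟧ ≡
                          (if lookup C v then 0 else ⟦ adj G u v ∧ not (lookup I₁ v) ⟧)
        pointwise v rewrite lookup-─ (∁ C) I₁ v | lookup-map v not C with lookup C v
        ... | true  = cong ⟦_⟧ (∧-zeroʳ (adj G u v))
        ... | false = refl

      outerCrossings-false : ∀ u → outerCrossings u false ≡ ∣ N G u ∩ I₁ ∣
      outerCrossings-false u = sym (trans (∣N∩p∣≡∑ G u I₁) (∑-cong vs λ v _ → pointwise v))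
        where
        pointwise : ∀ v → ⟦ adj G u v ∧ lookup I₁ v ⟧ ≡
                          (if lookup C v then 0 else ⟦ adj G u v ∧ lookup I₁ v ⟧)
        pointwise v with lookup C v in eq
        ... | true  = cong ⟦_⟧ (trans (cong (adj G u v ∧_) (I₁-disjoint eq)) (∧-zeroʳ (adj G u v)))
        ... | false = refl

      outerCrossings-sorted : Linked (λ u v → key G I₁ (∁ C ─ I₁) v ℤ.≤ key G I₁ (∁ C ─ I₁) u) L →
                              AllPairs (Dominates outerCrossings) L
      outerCrossings-sorted sorted =
        AllPairs.map dominates (Linked⇒AllPairs (λ u≥v v≥w → ℤ.≤-trans v≥w u≥v) sorted)
        where
        dominates : ∀ {u v} → key G I₁ (∁ C ─ I₁) v ℤ.≤ key G I₁ (∁ C ─ I₁) u →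
                    Dominates outerCrossings u v
        dominates {u} {v} le = subst₂ _≤_
          (sym (cong₂ _+_ (outerCrossings-true v) (outerCrossings-false u)))
          (sym (cong₂ _+_ (outerCrossings-true u) (outerCrossings-false v)))
          (m-n≤o-p⇒m+p≤o+n {∣ N G v ∩ (∁ C ─ I₁) ∣} {∣ N G v ∩ I₁ ∣}
                            {∣ N G u ∩ (∁ C ─ I₁) ∣} {∣ N G u ∩ I₁ ∣} le)

      lookup-candidate : ∀ m u → lookup (candidate I₁ L m) u ≡ does (u ∈? take m L) ∨ lookup I₁ u
      lookup-candidate m u = trans (lookup-zipWith _∨_ u (listSet (take m L)) I₁)
                                   (cong (_∨ lookup I₁ u) (lookup-listSet (take m L) u))

      candidate-agrees : ∀ m → AgreesOutside (lookup (candidate I₁ L m))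
      candidate-agrees m u u∉C = trans (lookup-candidate m u) (cong (_∨ lookup I₁ u)
        (dec-false (u ∈? take m L) λ u∈take →
          contradiction (trans (sym u∉C) (∈⇒lookup≡true L↔C (Sublist.lookup (take-⊆ m L) u∈take))) λ ()))

      ∑-candidate : ∀ (w : Fin n → Bool → ℕ) m →
        ∑ L (λ u → w u (lookup (candidate I₁ L m) u)) ≡ topSum w m L
      ∑-candidate w m = trans (∑-cong L λ u u∈L → cong (w u) (on-L u∈L)) (∑-take≡topSum w m L-unique)
        where
        on-L : ∀ {u} → u ∈ L → lookup (candidate I₁ L m) u ≡ does (u ∈? take m L)
        on-L {u} u∈L = trans (lookup-candidate m u)
          (trans (cong (does (u ∈? take m L) ∨_) (I₁-disjoint (∈⇒lookup≡true L↔C u∈L))) (∨-identityʳ _))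

      count-candidate : ∀ {m} → m ≤ length L → count (lookup (candidate I₁ L m)) L ≡ m
      count-candidate {m} m≤∣L∣ = trans (∑-candidate (λ _ → ⟦_⟧) m) (topSum-count L m≤∣L∣)

cutSize≤candidate : ∀ {n} (G : Graph n) {C} → IsClique G C → ∀ W {L} →
  ValidOrder G C (W ∩ ∁ C) (∁ C ─ (W ∩ ∁ C)) L →
  cutSize G W ≤ cutSize G (candidate (W ∩ ∁ C) L (count (lookup W) L))
cutSize≤candidate G {C} clique W {L} (L-unique , L↔C , L-sorted) =
  *-cancelˡ-≤ 2 (subst₂ _≤_ (crossings≡2*cutSize G W) (crossings≡2*cutSize G V)
    (crossings-mono W-agrees (candidate-agrees I₁⊆∁C m) (sym (count-candidate I₁⊆∁C m≤∣L∣)) (begin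
      ∑ L (λ u → outerCrossings u (lookup W u))
        ≤⟨ ∑≤topSum (lookup W) (outerCrossings-sorted I₁⊆∁C L-sorted) ⟩
      topSum outerCrossings m L
        ≡⟨ ∑-candidate I₁⊆∁C outerCrossings m ⟨
      ∑ L (λ u → outerCrossings u (lookup V u)) ∎)))
  where
  open ≤-Reasoning
  open CliqueSplit G clique L-unique L↔C
  I₁ = W ∩ ∁ C
  open Outside I₁
  I₁⊆∁C : I₁ ⊆ ∁ C
  I₁⊆∁C = p∩q⊆q W (∁ C)
  m : ℕ
  m = count (lookup W) L
  m≤∣L∣ : m ≤ length L
  m≤∣L∣ = count≤length (lookup W) L
  V = candidate I₁ L m
  W-agrees : AgreesOutside (lookup W)
  W-agrees u u∉C = sym (trans (lookup-zipWith _∧_ u W (∁ C))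
    (trans (cong (lookup W u ∧_) (trans (lookup-map u not C) (cong not u∉C))) (∧-identityʳ (lookup W u))))

candidates : ∀ {n} → Subset n → List (Subset n) → (Subset n → List (Fin n)) → List (Subset n)
candidates C subs ord = concatMap (λ I₁ → map (candidate I₁ (ord I₁)) (upTo (suc ∣ C ∣))) subs

candidate-∈ : ∀ {n} {C : Subset n} {subs} {ord : Subset n → List (Fin n)} {I₁ m} →
  I₁ ∈ subs → m ≤ ∣ C ∣ → candidate I₁ (ord I₁) m ∈ candidates C subs ord
candidate-∈ {C = C} {ord = ord} I₁∈subs m≤∣C∣ =
  ∈-concatMap⁺ (λ I₁ → map (candidate I₁ (ord I₁)) (upTo (suc ∣ C ∣)))
    (Any.map (λ { refl → ∈-map⁺ (candidate _ (ord _)) (∈-upTo⁺ (s≤s m≤∣C∣)) }) I₁∈subs)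

module _ {n} (G : Graph n) where

  ValidRecord : Subset n × ℕ → Set
  ValidRecord (best , b) = b ≤ cutSize G best

  step-valid : ∀ {r} S → ValidRecord r → ValidRecord (step G r S)
  step-valid {best , b} S valid with b ≤ᵇ cutSize G S
  ... | true  = ≤-refl
  ... | false = valid

  step-≥-record : ∀ r S → proj₂ r ≤ proj₂ (step G r S)
  step-≥-record (best , b) S with b ≤ᵇ cutSize G S | ≤ᵇ-reflects-≤ b (cutSize G S)
  ... | true  | ofʸ b≤S = b≤S
  ... | false | _       = ≤-refl

  step-≥-candidate : ∀ r S → cutSize G S ≤ proj₂ (step G r S)
  step-≥-candidate (best , b) S with b ≤ᵇ cutSize G S | ≤ᵇ-reflects-≤ b (cutSize G S)
  ... | true  | _       = ≤-refl
  ... | false | ofⁿ b≰S = <⇒≤ (≰⇒> b≰S)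

  foldl-valid : ∀ xs {r} → ValidRecord r → ValidRecord (foldl (step G) r xs)
  foldl-valid []       valid = valid
  foldl-valid (S ∷ xs) valid = foldl-valid xs (step-valid S valid)

  foldl-≥-record : ∀ xs r → proj₂ r ≤ proj₂ (foldl (step G) r xs)
  foldl-≥-record []       r = ≤-refl
  foldl-≥-record (S ∷ xs) r = ≤-trans (step-≥-record r S) (foldl-≥-record xs (step G r S))

  foldl-≥-member : ∀ {xs} r {S} → S ∈ xs → cutSize G S ≤ proj₂ (foldl (step G) r xs)
  foldl-≥-member {S ∷ xs} r (here refl)  = ≤-trans (step-≥-candidate r S) (foldl-≥-record xs (step G r S))
  foldl-≥-member {T ∷ xs} r (there S∈xs) = foldl-≥-member (step G r T) S∈xs

  procedure-≥ : ∀ C subs ord {S} → S ∈ candidates C subs ord →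
    cutSize G S ≤ cutSize G (procedure G C subs ord)
  procedure-≥ C subs ord S∈ =
    ≤-trans (foldl-≥-member (⊥ , 0) S∈) (foldl-valid (candidates C subs ord) z≤n)

lemma2 : ∀ {n} (G : Graph n) (C : Subset n) → IsClique G C →
    (subs : List (Subset n)) → ValidEnum (∁ C) subs →
    (ord : Subset n → List (Fin n)) →
    (∀ I₁ → I₁ ⊆ ∁ C → ValidOrder G C I₁ (∁ C ─ I₁) (ord I₁)) →
    IsMaxCut G (procedure G C subs ord)
lemma2 G C clique subs (subs-complete , _) ord valid W = begin
  cutSize G W
    ≤⟨ cutSize≤candidate G clique W ordered ⟩
  cutSize G (candidate I₁ (ord I₁) m)
    ≤⟨ procedure-≥ G C subs ord (candidate-∈ {C = C} (subs-complete I₁ I₁⊆∁C) m≤∣C∣) ⟩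
  cutSize G (procedure G C subs ord) ∎
  where
  open ≤-Reasoning
  I₁ = W ∩ ∁ C
  I₁⊆∁C : I₁ ⊆ ∁ C
  I₁⊆∁C = p∩q⊆q W (∁ C)
  ordered : ValidOrder G C I₁ (∁ C ─ I₁) (ord I₁)
  ordered = valid I₁ I₁⊆∁C
  m : ℕ
  m = count (lookup W) (ord I₁)
  m≤∣C∣ : m ≤ ∣ C ∣
  m≤∣C∣ = subst (m ≤_) (length≡∣p∣ (proj₁ (proj₂ ordered)) (proj₁ ordered))
                (count≤length (lookup W) (ord I₁))
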